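{- Let $n\in\mathbb{N}$. Then: (i) For $p,q\in\mathbb{N}$ with $5F_{n+2}-4 \le p < 5F_{n+3}-4$, $5F_{n+1}-4\le q<5F_{n+2}-4$ and $b_q=a_p+1$: (i.1) if $b_{q+1}-b_q=3$, then $a_{p+1}=a_p+2$, $a_{p+2}=a_p+3$ and $b_{q+1}=a_{p+2}+1$; (i.2) if $b_{q+1}-b_q=2$, then $a_{p+1}=a_p+2$ and $b_{q+1}=a_{p+1}+1$. (ii) $\{a_{5F_{n+2}-4+u}: u=0,1,\dots,5F_{n+1}\}\cup\{b_{5F_{n+1}-4+u}: u=0,1,\dots,5F_n\} = \{5F_{n+3}-4, 5F_{n+3}-3,\dots,5F_{n+4}-3\}$. (iii) $\{a_{5F_{n+2}-4+u}: u=0,1,\dots,5F_{n+1}\}\cap\{b_{5F_{n+1}-4+u}: u=0,1,\dots,5F_n\} = \emptyset$. (iv) $\{a_m : m\in\mathbb{N}\}\cap\{b_m : m\in\mathbb{N}\}=\emptyset$. (v) $\{a_m : m\in\mathbb{N}\}\cup\{b_m : m\in\mathbb{N}\}=\{6,7,8,\dots\}$.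
   Context: $F_1=F_2=1$, $F_{i+2}=F_{i+1}+F_i$ is the Fibonacci sequence. Let $\sigma$ be the substitution on finite lists over $\{1,2\}$ acting letterwise by $\sigma(1)=2$, $\sigma(2)=2,1$. Let $C_1=(1,1,1,1,1)$ and $C_{i+1}=\sigma(C_i)$. Let $(c_n)_{n\in\mathbb{N}}$ be the infinite sequence obtained by concatenating $C_1, C_2, C_3, \dots$ in this order, and let $d_n=c_n+1$. Define $a_n = 6+\sum_{i=1}^{n-1} c_i$ and $b_n=12+\sum_{i=1}^{n-1} d_i$ for $n\in\mathbb{N}$ (so $a_1=6$, $b_1=12$). -}

module Defs where

open import Data.Nat using (ℕ; zero; suc; _+_; _*_; _∸_)
open import Data.List using (List; []; _∷_; _++_; concatMap; replicate; sum; map; upTo)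

F : ℕ → ℕ
F zero = zero
F (suc zero) = 1
F (suc (suc i)) = F (suc i) + F i

-- the substitution σ on letters 1 ↦ 2, 2 ↦ 2,1 (only letters 1, 2 occur)
σ-letter : ℕ → List ℕ
σ-letter 1 = 2 ∷ []
σ-letter 2 = 2 ∷ 1 ∷ []
σ-letter _ = []

σ : List ℕ → List ℕ
σ = concatMap σ-letter

C : ℕ → List ℕ
C zero = []
C (suc zero) = replicate 5 1
C (suc (suc i)) = σ (C (suc i))

prefix : ℕ → List ℕ
prefix zero = []
prefix (suc k) = prefix k ++ C (suc k)

-- k-th element (0-based) of a list, default 0
nth : List ℕ → ℕ → ℕ
nth [] _ = 0
nth (x ∷ xs) zero = x
nth (x ∷ xs) (suc k) = nth xs k

-- c n (n ≥ 1) is the n-th entry (1-based) of the infinite concatenation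
-- C 1 C 2 C 3 ... ; since every C i is nonempty, the first n blocks already
-- contain at least n entries, so the prefix of n blocks suffices.
c : ℕ → ℕ
c n = nth (prefix n) (n ∸ 1)

d : ℕ → ℕ
d n = c n + 1

sumTo : (ℕ → ℕ) → ℕ → ℕ
sumTo f zero = 0
sumTo f (suc k) = sumTo f k + f (suc k)

a : ℕ → ℕ
a n = 6 + sumTo c (n ∸ 1)

b : ℕ → ℕ
b n = 12 + sumTo d (n ∸ 1)

{-# OPTIONS --safe #-}
module Submission where

-- Write ℓ n = |C₁ ⋯ Cₙ| and base n = 6 + Σ (C₁ ⋯ Cₙ).  On the indices of the block
-- C₍ₙ₊₁₎ = σ Cₙ the sequence a runs through base n plus the partial sums of σ Cₙ, and
-- on the indices of Cₙ the sequence b runs through base n + 1 plus the partial sums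
-- of Cₙ + 1 (every letter increased by one).  For a word w over {1, 2}, a letter 1
-- contributes the step 2 both to σ w and to w + 1, and a letter 2 contributes the
-- steps 2, 1 to σ w and the step 3 to w + 1.  Hence the partial sums of σ w and one
-- plus those of w + 1 alternate and partition [0, Σ σ w + 1], and where a point of
-- the second kind directly follows one of the first, the letters of σ w there are
-- dictated by the corresponding letter of w.  The windows [base n, base (n + 1) + 1]
-- are stacked end to end, which gives (iv) and (v).  Finally σ acts on
-- (length, sum) as (ℓ, s) ↦ (s, s + ℓ), so |Cₙ| = 5 Fₙ and Σ Cₙ = 5 F₍ₙ₊₁₎.

open import Defs
open import Data.Nat
open import Data.Nat.Properties
open import Data.Nat.ListAction using (sum)
open import Data.Nat.ListAction.Properties using (sum-++)
open import Data.Nat.Tactic.RingSolver using (solve-∀)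
open import Algebra.Properties.CommutativeSemigroup +-commutativeSemigroup using (interchange; xy∙z≈xz∙y)
open import Data.List using (List; []; _∷_; _++_; length; map; take)
open import Data.List.Properties using (length-++; length-take; take-map)
open import Data.Product using (_×_; Σ-syntax; ∃-syntax; _,_; proj₁; proj₂; uncurry)
open import Data.Sum using (_⊎_; inj₁; inj₂)
open import Data.Empty using (⊥-elim)
open import Relation.Nullary using (yes; no)
open import Relation.Binary.Definitions using (tri<; tri≈; tri>)
open import Relation.Binary.PropositionalEquality
open import Function.Bundles using (_⇔_; mk⇔)

sum-map-suc : ∀ xs → sum (map suc xs) ≡ sum xs + length xs
sum-map-suc []       = refl
sum-map-suc (x ∷ xs) = trans (cong (suc x +_) (sum-map-suc xs))
  (trans (cong suc (sym (+-assoc x (sum xs) (length xs)))) (sym (+-suc (x + sum xs) (length xs))))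

sum-take-≤ : ∀ t xs → sum (take t xs) ≤ sum xs
sum-take-≤ zero    xs       = z≤n
sum-take-≤ (suc t) []       = z≤n
sum-take-≤ (suc t) (x ∷ xs) = +-monoʳ-≤ x (sum-take-≤ t xs)

sum-take-map-suc : ∀ {t} xs → t ≤ length xs → sum (take t (map suc xs)) ≡ sum (take t xs) + t
sum-take-map-suc {t} xs t≤ = begin
  sum (take t (map suc xs))                   ≡⟨ cong sum (take-map t xs) ⟩
  sum (map suc (take t xs))                   ≡⟨ sum-map-suc (take t xs) ⟩
  sum (take t xs) + length (take t xs)        ≡⟨ cong (sum (take t xs) +_) length-take-t ⟩
  sum (take t xs) + t                         ∎
  where
  open ≡-Reasoning
  length-take-t : length (take t xs) ≡ t
  length-take-t = trans (length-take t xs) (m≤n⇒m⊓n≡m t≤)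

sum-take-suc : ∀ xs {k} → k < length xs → sum (take (suc k) xs) ≡ sum (take k xs) + nth xs k
sum-take-suc (x ∷ xs) {zero}  _         = +-comm x 0
sum-take-suc (x ∷ xs) {suc k} (s≤s k<) =
  trans (cong (x +_) (sum-take-suc xs k<)) (sym (+-assoc x _ _))

take-++ : ∀ {A : Set} (xs ys : List A) t → take (length xs + t) (xs ++ ys) ≡ xs ++ take t ys
take-++ []       ys t = refl
take-++ (x ∷ xs) ys t = cong (x ∷_) (take-++ xs ys t)

nth-++ˡ : ∀ xs ys {k} → k < length xs → nth (xs ++ ys) k ≡ nth xs k
nth-++ˡ (x ∷ xs) ys {zero}  _         = refl
nth-++ˡ (x ∷ xs) ys {suc k} (s≤s k<) = nth-++ˡ xs ys k<

nth-++ʳ : ∀ xs ys k → nth (xs ++ ys) (length xs + k) ≡ nth ys k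
nth-++ʳ []       ys k = refl
nth-++ʳ (x ∷ xs) ys k = nth-++ʳ xs ys k

nth≡suc⇒< : ∀ xs {k m} → nth xs k ≡ suc m → k < length xs
nth≡suc⇒< (x ∷ xs) {zero}  _  = s≤s z≤n
nth≡suc⇒< (x ∷ xs) {suc k} eq = s≤s (nth≡suc⇒< xs eq)

data Word₁₂ : List ℕ → Set where
  []  : Word₁₂ []
  1∷_ : ∀ {w} → Word₁₂ w → Word₁₂ (1 ∷ w)
  2∷_ : ∀ {w} → Word₁₂ w → Word₁₂ (2 ∷ w)

σ-word : ∀ {w} → Word₁₂ w → Word₁₂ (σ w)
σ-word []      = []
σ-word (1∷ w) = 2∷ σ-word w
σ-word (2∷ w) = 2∷ 1∷ σ-word w

length-σ : ∀ {w} → Word₁₂ w → length (σ w) ≡ sum w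
length-σ []     = refl
length-σ (1∷ w) = cong suc (length-σ w)
length-σ (2∷ w) = cong (2 +_) (length-σ w)

sum-σ : ∀ {w} → Word₁₂ w → sum (σ w) ≡ sum w + length w
sum-σ []             = refl
sum-σ (1∷_ {w} ww) = cong suc (trans (cong suc (sum-σ ww)) (sym (+-suc (sum w) (length w))))
sum-σ (2∷_ {w} ww) = cong (2 +_) (trans (cong suc (sum-σ ww)) (sym (+-suc (sum w) (length w))))

sum-map-suc-σ : ∀ {w} → Word₁₂ w → sum (map suc w) ≡ sum (σ w)
sum-map-suc-σ {w} ww = trans (sum-map-suc w) (sym (sum-σ ww))

sum-take-< : ∀ {w t} → Word₁₂ w → t < length w → sum (take t w) < sum w
sum-take-< {t = zero}  (1∷ w) _         = s≤s z≤n
sum-take-< {t = suc t} (1∷ w) (s≤s t<) = s≤s (sum-take-< w t<)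
sum-take-< {t = zero}  (2∷ w) _         = s≤s z≤n
sum-take-< {t = suc t} (2∷ w) (s≤s t<) = s≤s (s≤s (sum-take-< w t<))

interleave-cover : ∀ {w} → Word₁₂ w → ∀ k → k ≤ suc (sum (σ w)) →
  (∃[ t ] t ≤ length (σ w) × sum (take t (σ w)) ≡ k) ⊎
  (∃[ t ] t ≤ length w × suc (sum (take t (map suc w))) ≡ k)
interleave-cover w      zero          _ = inj₁ (0 , z≤n , refl)
interleave-cover w      (suc zero)    _ = inj₂ (0 , z≤n , refl)
interleave-cover []     (suc (suc k)) (s≤s ())
interleave-cover (1∷ w) (suc (suc k)) (s≤s (s≤s k≤)) with interleave-cover w k k≤
... | inj₁ (t , t≤ , eq) = inj₁ (suc t , s≤s t≤ , cong (2 +_) eq)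
... | inj₂ (t , t≤ , eq) = inj₂ (suc t , s≤s t≤ , cong (2 +_) eq)
interleave-cover (2∷ w) (suc (suc zero)) _ = inj₁ (1 , s≤s z≤n , refl)
interleave-cover (2∷ w) (suc (suc (suc k))) (s≤s (s≤s (s≤s k≤))) with interleave-cover w k k≤
... | inj₁ (t , t≤ , eq) = inj₁ (suc (suc t) , s≤s (s≤s t≤) , cong (3 +_) eq)
... | inj₂ (t , t≤ , eq) = inj₂ (suc t , s≤s t≤ , cong (3 +_) eq)

interleave-disjoint : ∀ {w} → Word₁₂ w → ∀ t t′ →
  sum (take t (σ w)) ≢ suc (sum (take t′ (map suc w)))
interleave-disjoint []     zero          t′       ()
interleave-disjoint []     (suc t)       t′       ()
interleave-disjoint (1∷ w) zero          t′       ()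
interleave-disjoint (1∷ w) (suc t)       zero     ()
interleave-disjoint (1∷ w) (suc t)       (suc t′) eq = interleave-disjoint w t t′ (+-cancelˡ-≡ 2 _ _ eq)
interleave-disjoint (2∷ w) zero          t′       ()
interleave-disjoint (2∷ w) (suc zero)    zero     ()
interleave-disjoint (2∷ w) (suc zero)    (suc t′) ()
interleave-disjoint (2∷ w) (suc (suc t)) zero     ()
interleave-disjoint (2∷ w) (suc (suc t)) (suc t′) eq = interleave-disjoint w t t′ (+-cancelˡ-≡ 3 _ _ eq)

interleave-b<top : ∀ {w t} → Word₁₂ w → t < length w → suc (sum (take t (map suc w))) < sum (σ w)
interleave-b<top {t = zero}  (1∷ w) _         = s≤s (s≤s z≤n)
interleave-b<top {t = suc t} (1∷ w) (s≤s t<) = s≤s (s≤s (interleave-b<top w t<))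
interleave-b<top {t = zero}  (2∷ w) _         = s≤s (s≤s z≤n)
interleave-b<top {t = suc t} (2∷ w) (s≤s t<) = s≤s (s≤s (s≤s (interleave-b<top w t<)))

interleave-adjacent : ∀ {w t t′} → Word₁₂ w → t′ < length w →
  sum (take t′ (map suc w)) ≡ sum (take t (σ w)) →
  (nth w t′ ≡ 1 → nth (σ w) t ≡ 2) × (nth w t′ ≡ 2 → nth (σ w) t ≡ 2 × nth (σ w) (suc t) ≡ 1)
interleave-adjacent {t = zero}        {zero}   (1∷ w) _ _ = (λ _ → refl) , λ ()
interleave-adjacent {t = suc t}       {zero}   (1∷ w) _ ()
interleave-adjacent {t = zero}        {suc t′} (1∷ w) _ ()
interleave-adjacent {t = suc t}       {suc t′} (1∷ w) (s≤s t′<) eq =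
  interleave-adjacent w t′< (+-cancelˡ-≡ 2 _ _ eq)
interleave-adjacent {t = zero}        {zero}   (2∷ w) _ _ = (λ ()) , λ _ → refl , refl
interleave-adjacent {t = suc t}       {zero}   (2∷ w) _ ()
interleave-adjacent {t = zero}        {suc t′} (2∷ w) _ ()
interleave-adjacent {t = suc zero}    {suc t′} (2∷ w) _ ()
interleave-adjacent {t = suc (suc t)} {suc t′} (2∷ w) (s≤s t′<) eq =
  interleave-adjacent w t′< (+-cancelˡ-≡ 3 _ _ eq)

module StrictlyIncreasing (f : ℕ → ℕ) (f-< : ∀ n → f n < f (suc n)) where

  mono : ∀ {m n} → m ≤ n → f m ≤ f n
  mono m≤n = mono′ (≤⇒≤′ m≤n)
    where
    mono′ : ∀ {m n} → m ≤′ n → f m ≤ f n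
    mono′ ≤′-refl        = ≤-refl
    mono′ (≤′-step m≤n) = ≤-trans (mono′ m≤n) (<⇒≤ (f-< _))

  n≤f[n] : ∀ n → n ≤ f n
  n≤f[n] zero    = z≤n
  n≤f[n] (suc n) = ≤-<-trans (n≤f[n] n) (f-< n)

  bracket : ∀ {v} → f 0 ≤ v → ∃[ n ] f n ≤ v × v < f (suc n)
  bracket {v} f0≤v = below (suc v) (n≤f[n] (suc v))
    where
    below : ∀ N → v < f N → ∃[ n ] f n ≤ v × v < f (suc n)
    below zero    v<f0 = ⊥-elim (<⇒≱ v<f0 f0≤v)
    below (suc N) v<fN+1 with v <? f N
    ... | yes v<fN = below N v<fN
    ... | no  v≮fN = N , ≮⇒≥ v≮fN , v<fN+1

C-word : ∀ n → Word₁₂ (C (suc n))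
C-word zero    = 1∷ 1∷ 1∷ 1∷ 1∷ []
C-word (suc n) = σ-word (C-word n)

-- Block C (n + 1) fills the indices 1 + ℓ n, …, ℓ (n + 1) of c, and base n = a (1 + ℓ n).
-- In the statement's terms ℓ n = 5 F (n + 2) − 5 and base n = 5 F (n + 3) − 4.
ℓ : ℕ → ℕ
ℓ n = length (prefix n)

base : ℕ → ℕ
base n = 6 + sum (prefix n)

ℓ-suc : ∀ n → ℓ (suc n) ≡ ℓ n + length (C (suc n))
ℓ-suc n = length-++ (prefix n)

base-suc : ∀ n → base (suc n) ≡ base n + sum (C (suc n))
base-suc n = trans (cong (6 +_) (sum-++ (prefix n) (C (suc n)))) (sym (+-assoc 6 (sum (prefix n)) (sum (C (suc n)))))

sum-C : ∀ n → sum (C (suc n)) ≡ 5 + ℓ n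
sum-C zero    = refl
sum-C (suc n) = begin
  sum (σ (C (suc n)))                     ≡⟨ sum-σ (C-word n) ⟩
  sum (C (suc n)) + length (C (suc n))    ≡⟨ cong (_+ length (C (suc n))) (sum-C n) ⟩
  5 + ℓ n + length (C (suc n))            ≡⟨ cong (5 +_) (sym (ℓ-suc n)) ⟩
  5 + ℓ (suc n)                           ∎
  where open ≡-Reasoning

base≡1+ℓ : ∀ n → base n ≡ suc (ℓ (suc n))
base≡1+ℓ zero    = refl
base≡1+ℓ (suc n) = begin
  base (suc n)                                  ≡⟨ base-suc n ⟩
  base n + sum (C (suc n))                      ≡⟨ cong₂ _+_ (base≡1+ℓ n) (sym (length-σ (C-word n))) ⟩
  suc (ℓ (suc n) + length (C (suc (suc n))))    ≡⟨ cong suc (sym (ℓ-suc (suc n))) ⟩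
  suc (ℓ (suc (suc n)))                         ∎
  where open ≡-Reasoning

length-C>0 : ∀ n → 0 < length (C (suc n))
length-C>0 zero    = s≤s z≤n
length-C>0 (suc n) = subst (0 <_) (sym (length-σ (C-word n))) (sum-take-< (C-word n) (length-C>0 n))

ℓ-< : ∀ n → ℓ n < ℓ (suc n)
ℓ-< n = subst (ℓ n <_) (sym (ℓ-suc n)) (m<m+n (ℓ n) (length-C>0 n))

base-< : ∀ n → base n < base (suc n)
base-< n = subst₂ _<_ (sym (base≡1+ℓ n)) (sym (base≡1+ℓ (suc n))) (s≤s (ℓ-< (suc n)))

module ℓ = StrictlyIncreasing ℓ ℓ-<
module base = StrictlyIncreasing base base-<

nth-prefix : ∀ {M N k} → M ≤′ N → k < ℓ M → nth (prefix N) k ≡ nth (prefix M) k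
nth-prefix ≤′-refl          _    = refl
nth-prefix {M} (≤′-step {N} M≤N) k<ℓM =
  trans (nth-++ˡ (prefix N) (C (suc N)) (≤-trans k<ℓM (ℓ.mono (≤′⇒≤ M≤N)))) (nth-prefix M≤N k<ℓM)

c-prefix : ∀ K {k} → k < ℓ K → c (suc k) ≡ nth (prefix K) k
c-prefix K {k} k<ℓK with ≤-total K (suc k)
... | inj₁ K≤1+k = nth-prefix (≤⇒≤′ K≤1+k) k<ℓK
... | inj₂ 1+k≤K = sym (nth-prefix (≤⇒≤′ 1+k≤K) (ℓ.n≤f[n] (suc k)))

c-block : ∀ n {t} → t < length (C (suc n)) → c (suc (ℓ n + t)) ≡ nth (C (suc n)) t
c-block n {t} t< = trans (c-prefix (suc n) ℓn+t<) (nth-++ʳ (prefix n) (C (suc n)) t)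
  where
  ℓn+t< : ℓ n + t < ℓ (suc n)
  ℓn+t< = subst (ℓ n + t <_) (sym (ℓ-suc n)) (+-monoʳ-< (ℓ n) t<)

sumTo-c : ∀ K {k} → k ≤ ℓ K → sumTo c k ≡ sum (take k (prefix K))
sumTo-c K {zero}  _     = refl
sumTo-c K {suc k} k<ℓK =
  trans (cong₂ _+_ (sumTo-c K (<⇒≤ k<ℓK)) (c-prefix K k<ℓK)) (sym (sum-take-suc (prefix K) k<ℓK))

a-block : ∀ n {t} → t ≤ length (C (suc n)) → a (suc (ℓ n + t)) ≡ base n + sum (take t (C (suc n)))
a-block n {t} t≤ = begin
  6 + sumTo c (ℓ n + t)                               ≡⟨ cong (6 +_) (sumTo-c (suc n) ℓn+t≤) ⟩
  6 + sum (take (ℓ n + t) (prefix n ++ C (suc n)))    ≡⟨ cong (λ xs → 6 + sum xs) (take-++ (prefix n) _ t) ⟩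
  6 + sum (prefix n ++ take t (C (suc n)))            ≡⟨ cong (6 +_) (sum-++ (prefix n) _) ⟩
  6 + (sum (prefix n) + sum (take t (C (suc n))))     ≡⟨ sym (+-assoc 6 (sum (prefix n)) _) ⟩
  base n + sum (take t (C (suc n)))                   ∎
  where
  open ≡-Reasoning
  ℓn+t≤ : ℓ n + t ≤ ℓ (suc n)
  ℓn+t≤ = subst (ℓ n + t ≤_) (sym (ℓ-suc n)) (+-monoʳ-≤ (ℓ n) t≤)

sumTo-d : ∀ k → sumTo d k ≡ sumTo c k + k
sumTo-d zero    = refl
sumTo-d (suc k) = begin
  sumTo d k + (c (suc k) + 1)          ≡⟨ cong (_+ (c (suc k) + 1)) (sumTo-d k) ⟩
  sumTo c k + k + (c (suc k) + 1)      ≡⟨ interchange (sumTo c k) k (c (suc k)) 1 ⟩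
  sumTo c k + c (suc k) + (k + 1)      ≡⟨ cong (sumTo c k + c (suc k) +_) (+-comm k 1) ⟩
  sumTo c (suc k) + suc k              ∎
  where open ≡-Reasoning

b-via-a : ∀ k → b (suc k) ≡ 6 + (a (suc k) + k)
b-via-a k = cong (12 +_) (sumTo-d k)

b-block : ∀ n {t} → t ≤ length (C (suc n)) →
  b (suc (ℓ n + t)) ≡ base (suc n) + suc (sum (take t (map suc (C (suc n)))))
b-block n {t} t≤ = begin
  b (suc (ℓ n + t))                      ≡⟨ b-via-a (ℓ n + t) ⟩
  6 + (a (suc (ℓ n + t)) + (ℓ n + t))    ≡⟨ cong (λ y → 6 + (y + (ℓ n + t))) (a-block n t≤) ⟩
  6 + (base n + S + (ℓ n + t))           ≡⟨ rearrange (base n) S (ℓ n) t ⟩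
  base n + (5 + ℓ n) + suc (S + t)       ≡⟨ cong₂ (λ y z → base n + y + suc z)
                                                    (sym (sum-C n)) (sym (sum-take-map-suc (C (suc n)) t≤)) ⟩
  base n + sum (C (suc n)) + suc S′      ≡⟨ cong (_+ suc S′) (sym (base-suc n)) ⟩
  base (suc n) + suc S′                  ∎
  where
  open ≡-Reasoning
  S = sum (take t (C (suc n)))
  S′ = sum (take t (map suc (C (suc n))))
  rearrange : ∀ x s l t → 6 + (x + s + (l + t)) ≡ x + (5 + l) + suc (s + t)
  rearrange = solve-∀

a-step : ∀ {p} → 1 ≤ p → a (p + 1) ≡ a p + c p
a-step {suc k} _ = trans (cong (λ i → 6 + sumTo c i) (+-comm k 1)) (sym (+-assoc 6 (sumTo c k) (c (suc k))))

b-step : ∀ {q} → 1 ≤ q → b (q + 1) ≡ b q + d q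
b-step {suc k} _ = trans (cong (λ i → 12 + sumTo d i) (+-comm k 1)) (sym (+-assoc 12 (sumTo d k) (d (suc k))))

neighbours : ∀ {p q} → 1 ≤ p → 1 ≤ q → b q ≡ a p + 1 →
  (c q ≡ 1 → c p ≡ 2) × (c q ≡ 2 → c p ≡ 2 × c (p + 1) ≡ 1) →
  (b (q + 1) ∸ b q ≡ 3 → (a (p + 1) ≡ a p + 2) × (a (p + 2) ≡ a p + 3) × (b (q + 1) ≡ a (p + 2) + 1))
  × (b (q + 1) ∸ b q ≡ 2 → (a (p + 1) ≡ a p + 2) × (b (q + 1) ≡ a (p + 1) + 1))
neighbours {p} {q} 1≤p 1≤q bq≡ap+1 (one , two) = jump₃ , jump₂
  where
  c-q : ∀ {v} → b (q + 1) ∸ b q ≡ suc v → c q ≡ v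
  c-q {v} Δ = suc-injective (begin
    suc (c q)               ≡⟨ +-comm 1 (c q) ⟩
    d q                     ≡⟨ sym (m+n∸m≡n (b q) (d q)) ⟩
    b q + d q ∸ b q         ≡⟨ cong (_∸ b q) (sym (b-step 1≤q)) ⟩
    b (q + 1) ∸ b q         ≡⟨ Δ ⟩
    suc v                   ∎)
    where open ≡-Reasoning
  a-p+1 : c p ≡ 2 → a (p + 1) ≡ a p + 2
  a-p+1 cp≡2 = trans (a-step 1≤p) (cong (a p +_) cp≡2)
  b-q+1 : ∀ {v} → c q ≡ v → b (q + 1) ≡ a p + (v + 1) + 1
  b-q+1 {v} cq≡v =
    trans (b-step 1≤q) (trans (cong₂ _+_ bq≡ap+1 (cong (_+ 1) cq≡v)) (xy∙z≈xz∙y (a p) 1 (v + 1)))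
  a-p+2 : c p ≡ 2 → c (p + 1) ≡ 1 → a (p + 2) ≡ a p + 3
  a-p+2 cp≡2 cp+1≡1 = begin
    a (p + 2)               ≡⟨ cong a (sym (+-assoc p 1 1)) ⟩
    a (p + 1 + 1)           ≡⟨ a-step (≤-trans 1≤p (m≤m+n p 1)) ⟩
    a (p + 1) + c (p + 1)   ≡⟨ cong₂ _+_ (a-p+1 cp≡2) cp+1≡1 ⟩
    a p + 2 + 1             ≡⟨ +-assoc (a p) 2 1 ⟩
    a p + 3                 ∎
    where open ≡-Reasoning
  jump₃ : b (q + 1) ∸ b q ≡ 3 →
    (a (p + 1) ≡ a p + 2) × (a (p + 2) ≡ a p + 3) × (b (q + 1) ≡ a (p + 2) + 1)
  jump₃ Δ = a-p+1 cp≡2 , a-p+2 cp≡2 cp+1≡1 , trans (b-q+1 (c-q Δ)) (cong (_+ 1) (sym (a-p+2 cp≡2 cp+1≡1)))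
    where
    cp≡2 : c p ≡ 2
    cp≡2 = proj₁ (two (c-q Δ))
    cp+1≡1 : c (p + 1) ≡ 1
    cp+1≡1 = proj₂ (two (c-q Δ))
  jump₂ : b (q + 1) ∸ b q ≡ 2 → (a (p + 1) ≡ a p + 2) × (b (q + 1) ≡ a (p + 1) + 1)
  jump₂ Δ = a-p+1 cp≡2 , trans (b-q+1 (c-q Δ)) (cong (_+ 1) (sym (a-p+1 cp≡2)))
    where
    cp≡2 : c p ≡ 2
    cp≡2 = one (c-q Δ)

in-block : ∀ n {t} → ℓ n + t < ℓ (suc n) → t < length (C (suc n))
in-block n {t} h = +-cancelˡ-< (ℓ n) t _ (subst (ℓ n + t <_) (ℓ-suc n) h)

window-neighbours : ∀ m p q →
  suc (ℓ (suc m)) ≤ p → p < suc (ℓ (suc (suc m))) → suc (ℓ m) ≤ q → q < suc (ℓ (suc m)) →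
  b q ≡ a p + 1 → (c q ≡ 1 → c p ≡ 2) × (c q ≡ 2 → c p ≡ 2 × c (p + 1) ≡ 1)
window-neighbours m p q p≥ p< q≥ q< bq≡ap+1 with m≤n⇒∃[o]m+o≡n p≥ | m≤n⇒∃[o]m+o≡n q≥
... | t , refl | t′ , refl = after-1 , after-2
  where
  w : List ℕ
  w = C (suc m)
  t< : t < length (σ w)
  t< = in-block (suc m) (≤-pred p<)
  t′< : t′ < length w
  t′< = in-block m (≤-pred q<)
  A : ℕ
  A = sum (take t (σ w))
  B : ℕ
  B = sum (take t′ (map suc w))
  sums : B ≡ A
  sums = suc-injective (+-cancelˡ-≡ (base (suc m)) _ _ (begin
    base (suc m) + suc B          ≡⟨ sym (b-block m (<⇒≤ t′<)) ⟩
    b (suc (ℓ m + t′))            ≡⟨ bq≡ap+1 ⟩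
    a (suc (ℓ (suc m) + t)) + 1   ≡⟨ cong (_+ 1) (a-block (suc m) (<⇒≤ t<)) ⟩
    base (suc m) + A + 1          ≡⟨ +-assoc (base (suc m)) A 1 ⟩
    base (suc m) + (A + 1)        ≡⟨ cong (base (suc m) +_) (+-comm A 1) ⟩
    base (suc m) + suc A          ∎))
    where open ≡-Reasoning
  letters : (nth w t′ ≡ 1 → nth (σ w) t ≡ 2)
          × (nth w t′ ≡ 2 → nth (σ w) t ≡ 2 × nth (σ w) (suc t) ≡ 1)
  letters = interleave-adjacent (C-word m) t′< sums
  c-q : c (suc (ℓ m + t′)) ≡ nth w t′
  c-q = c-block m t′<
  c-p : c (suc (ℓ (suc m) + t)) ≡ nth (σ w) t
  c-p = c-block (suc m) t<
  c-p+1 : nth (σ w) (suc t) ≡ 1 → c (suc (ℓ (suc m) + t) + 1) ≡ 1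
  c-p+1 e = trans (cong (λ i → c (suc i)) (trans (+-comm _ 1) (sym (+-suc (ℓ (suc m)) t))))
                  (trans (c-block (suc m) (nth≡suc⇒< (σ w) e)) e)
  after-1 : c (suc (ℓ m + t′)) ≡ 1 → c (suc (ℓ (suc m) + t)) ≡ 2
  after-1 e = trans c-p (proj₁ letters (trans (sym c-q) e))
  after-2 : c (suc (ℓ m + t′)) ≡ 2 → c (suc (ℓ (suc m) + t)) ≡ 2 × c (suc (ℓ (suc m) + t) + 1) ≡ 1
  after-2 e = trans c-p (proj₁ σ-letters) , c-p+1 (proj₂ σ-letters)
    where
    σ-letters : nth (σ w) t ≡ 2 × nth (σ w) (suc t) ≡ 1
    σ-letters = proj₂ letters (trans (sym c-q) e)

window-bounds : ∀ m {v} →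
  (Σ[ u ∈ ℕ ] u ≤ length (C (suc (suc m))) × a (suc (ℓ (suc m) + u)) ≡ v)
  ⊎ (Σ[ u ∈ ℕ ] u ≤ length (C (suc m)) × b (suc (ℓ m + u)) ≡ v) →
  base (suc m) ≤ v × v ≤ suc (base (suc (suc m)))
window-bounds m (inj₁ (u , u≤ , refl)) rewrite a-block (suc m) u≤ | base-suc (suc m) =
  m≤m+n _ _ , m≤n⇒m≤1+n (+-monoʳ-≤ (base (suc m)) (sum-take-≤ u (σ (C (suc m)))))
window-bounds m (inj₂ (u , u≤ , refl)) rewrite b-block m u≤ | base-suc (suc m) =
  m≤m+n _ _ , subst (base (suc m) + suc B ≤_) (+-suc (base (suc m)) S) (+-monoʳ-≤ (base (suc m)) (s≤s B≤S))
  where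
  B S : ℕ
  B = sum (take u (map suc (C (suc m))))
  S = sum (σ (C (suc m)))
  B≤S : B ≤ S
  B≤S = ≤-trans (sum-take-≤ u (map suc (C (suc m)))) (≤-reflexive (sum-map-suc-σ (C-word m)))

window-cover : ∀ m {v} → base (suc m) ≤ v → v ≤ suc (base (suc (suc m))) →
  (Σ[ u ∈ ℕ ] u ≤ length (C (suc (suc m))) × a (suc (ℓ (suc m) + u)) ≡ v)
  ⊎ (Σ[ u ∈ ℕ ] u ≤ length (C (suc m)) × b (suc (ℓ m + u)) ≡ v)
window-cover m v≥ v≤ with m≤n⇒∃[o]m+o≡n v≥
... | k , refl with interleave-cover (C-word m) k k≤
  where
  k≤ : k ≤ suc (sum (σ (C (suc m))))
  k≤ = +-cancelˡ-≤ (base (suc m)) _ _ (subst (base (suc m) + k ≤_) top v≤)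
    where
    top : suc (base (suc (suc m))) ≡ base (suc m) + suc (sum (σ (C (suc m))))
    top = trans (cong suc (base-suc (suc m))) (sym (+-suc (base (suc m)) (sum (σ (C (suc m))))))
... | inj₁ (u , u≤ , eq) = inj₁ (u , u≤ , trans (a-block (suc m) u≤) (cong (base (suc m) +_) eq))
... | inj₂ (u , u≤ , eq) = inj₂ (u , u≤ , trans (b-block m u≤) (cong (base (suc m) +_) eq))

window-range : ∀ m v →
  ((Σ[ u ∈ ℕ ] u ≤ length (C (suc (suc m))) × a (suc (ℓ (suc m) + u)) ≡ v)
   ⊎ (Σ[ u ∈ ℕ ] u ≤ length (C (suc m)) × b (suc (ℓ m + u)) ≡ v))
  ⇔ (base (suc m) ≤ v × v ≤ suc (base (suc (suc m))))
window-range m v = mk⇔ (window-bounds m) (uncurry (window-cover m))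

window-disjoint : ∀ m u v → u ≤ length (C (suc (suc m))) → v ≤ length (C (suc m)) →
  a (suc (ℓ (suc m) + u)) ≢ b (suc (ℓ m + v))
window-disjoint m u v u≤ v≤ eq =
  interleave-disjoint (C-word m) u v
    (+-cancelˡ-≡ (base (suc m)) _ _ (trans (sym (a-block (suc m) u≤)) (trans eq (b-block m v≤))))

block-index : ∀ k → ∃[ n ] ∃[ t ] t < length (C (suc n)) × ℓ n + t ≡ k
block-index k with ℓ.bracket {k} z≤n
... | n , ℓn≤k , k<ℓ[1+n] with m≤n⇒∃[o]m+o≡n ℓn≤k
... | t , refl = n , t , in-block n k<ℓ[1+n] , refl

a-in-block : ∀ n {t} → t < length (C (suc n)) →
  base n ≤ a (suc (ℓ n + t)) × a (suc (ℓ n + t)) < base (suc n)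
a-in-block n {t} t< rewrite a-block n (<⇒≤ t<) | base-suc n =
  m≤m+n _ _ , +-monoʳ-< (base n) (sum-take-< (C-word n) t<)

b-in-block : ∀ n {t} → t < length (C (suc n)) →
  base (suc n) < b (suc (ℓ n + t)) × b (suc (ℓ n + t)) < base (suc (suc n))
b-in-block n {t} t< rewrite b-block n (<⇒≤ t<) | base-suc (suc n) =
  m<m+n (base (suc n)) (s≤s z≤n) , +-monoʳ-< (base (suc n)) (interleave-b<top (C-word n) t<)

a≢b : ∀ m m′ → 1 ≤ m → 1 ≤ m′ → a m ≢ b m′
a≢b (suc k) (suc k′) _ _ with block-index k | block-index k′
... | n , t , t< , refl | n′ , t′ , t′< , refl with <-cmp n (suc n′)
... | tri< n<1+n′ _ _ =
  <⇒≢ (<-trans (<-≤-trans (proj₂ (a-in-block n t<)) (base.mono n<1+n′)) (proj₁ (b-in-block n′ t′<)))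
... | tri≈ _ refl _ = window-disjoint n′ t t′ (<⇒≤ t<) (<⇒≤ t′<)
... | tri> _ _ 1+n′<n =
  >⇒≢ (<-≤-trans (proj₂ (b-in-block n′ t′<)) (≤-trans (base.mono 1+n′<n) (proj₁ (a-in-block n t<))))

a-initial : ∀ {k} → k < 5 → a (suc k) ≡ 6 + k
a-initial {0} _ = refl
a-initial {1} _ = refl
a-initial {2} _ = refl
a-initial {3} _ = refl
a-initial {4} _ = refl
a-initial {suc (suc (suc (suc (suc _))))} (s≤s (s≤s (s≤s (s≤s (s≤s ())))))

TermOfAOrB : ℕ → Set
TermOfAOrB v = (Σ[ m ∈ ℕ ] (1 ≤ m) × (a m ≡ v)) ⊎ (Σ[ m ∈ ℕ ] (1 ≤ m) × (b m ≡ v))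

a∪b : ∀ v → TermOfAOrB v ⇔ (6 ≤ v)
a∪b _ = mk⇔ at-least-6 covered
  where
  at-least-6 : ∀ {v} → TermOfAOrB v → 6 ≤ v
  at-least-6 (inj₁ (m , _ , refl)) = m≤m+n 6 _
  at-least-6 (inj₂ (m , _ , refl)) = m≤m+n 6 (6 + sumTo d (m ∸ 1))
  covered : ∀ {v} → 6 ≤ v → TermOfAOrB v
  covered 6≤v with base.bracket 6≤v | m≤n⇒∃[o]m+o≡n 6≤v
  ... | zero , _ , 6+k<11 | k , refl = inj₁ (suc k , s≤s z≤n , a-initial (+-cancelˡ-< 6 k 5 6+k<11))
  ... | suc m , v≥ , v< | _ with window-cover m v≥ (m≤n⇒m≤1+n (<⇒≤ v<))
  ...   | inj₁ (u , _ , eq) = inj₁ (suc (ℓ (suc m) + u) , s≤s z≤n , eq)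
  ...   | inj₂ (u , _ , eq) = inj₂ (suc (ℓ m + u) , s≤s z≤n , eq)

length-C-fib : ∀ n → length (C (suc n)) ≡ 5 * F (suc n)
sum-C-fib : ∀ n → sum (C (suc n)) ≡ 5 * F (suc (suc n))

length-C-fib zero    = refl
length-C-fib (suc n) = trans (length-σ (C-word n)) (sum-C-fib n)

sum-C-fib zero    = refl
sum-C-fib (suc n) = begin
  sum (σ (C (suc n)))                      ≡⟨ sum-σ (C-word n) ⟩
  sum (C (suc n)) + length (C (suc n))     ≡⟨ cong₂ _+_ (sum-C-fib n) (length-C-fib n) ⟩
  5 * F (suc (suc n)) + 5 * F (suc n)      ≡⟨ sym (*-distribˡ-+ 5 (F (suc (suc n))) (F (suc n))) ⟩
  5 * F (suc (suc (suc n)))                ∎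
  where open ≡-Reasoning

start-fib : ∀ n → 5 * F (2 + n) ∸ 4 ≡ suc (ℓ n)
start-fib n = cong (_∸ 4) (trans (sym (sum-C-fib n)) (sum-C n))

base-fib : ∀ n → 5 * F (3 + n) ∸ 4 ≡ base n
base-fib n = trans (start-fib (suc n)) (sym (base≡1+ℓ n))

end-fib : ∀ n → 5 * F (4 + n) ∸ 3 ≡ suc (base (suc n))
end-fib n = trans (cong (_∸ 3) (trans (sym (sum-C-fib (2 + n))) (sum-C (2 + n))))
                  (cong suc (sym (base≡1+ℓ (suc n))))

F-+-comm : ∀ n k → F (n + k) ≡ F (k + n)
F-+-comm n k = cong F (+-comm n k)

lemma4p3 : (n : ℕ) → 1 ≤ n →
    ((p q : ℕ) →
    5 * F (n + 2) ∸ 4 ≤ p → p < 5 * F (n + 3) ∸ 4 →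
    5 * F (n + 1) ∸ 4 ≤ q → q < 5 * F (n + 2) ∸ 4 →
    b q ≡ a p + 1 →
    (b (q + 1) ∸ b q ≡ 3 →
    (a (p + 1) ≡ a p + 2) × (a (p + 2) ≡ a p + 3) × (b (q + 1) ≡ a (p + 2) + 1))
    × (b (q + 1) ∸ b q ≡ 2 →
    (a (p + 1) ≡ a p + 2) × (b (q + 1) ≡ a (p + 1) + 1)))
    × ((x : ℕ) →
    ((Σ[ u ∈ ℕ ] (u ≤ 5 * F (n + 1)) × (a (5 * F (n + 2) ∸ 4 + u) ≡ x))
    ⊎ (Σ[ u ∈ ℕ ] (u ≤ 5 * F n) × (b (5 * F (n + 1) ∸ 4 + u) ≡ x)))
    ⇔ ((5 * F (n + 3) ∸ 4 ≤ x) × (x ≤ 5 * F (n + 4) ∸ 3)))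
    × ((u v : ℕ) → u ≤ 5 * F (n + 1) → v ≤ 5 * F n →
    a (5 * F (n + 2) ∸ 4 + u) ≢ b (5 * F (n + 1) ∸ 4 + v))
    × ((m m′ : ℕ) → 1 ≤ m → 1 ≤ m′ → a m ≢ b m′)
    × ((x : ℕ) →
    ((Σ[ m ∈ ℕ ] (1 ≤ m) × (a m ≡ x)) ⊎ (Σ[ m ∈ ℕ ] (1 ≤ m) × (b m ≡ x)))
    ⇔ (6 ≤ x))
-- The bound 5 F (n + 3) − 4 is rewritten to base n; as the bound on the index p it is 1 + ℓ (n + 1).
lemma4p3 (suc m) _
  rewrite F-+-comm (suc m) 1 | F-+-comm (suc m) 2 | F-+-comm (suc m) 3 | F-+-comm (suc m) 4
        | start-fib m | start-fib (suc m) | base-fib (suc m) | end-fib (suc m)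
        | sym (length-C-fib m) | sym (length-C-fib (suc m))
  = (λ p q p≥ p< q≥ q< bq≡ap+1 →
       neighbours (≤-trans (s≤s z≤n) p≥) (≤-trans (s≤s z≤n) q≥) bq≡ap+1
         (window-neighbours m p q p≥ (subst (p <_) (base≡1+ℓ (suc m)) p<) q≥ q< bq≡ap+1))
  , window-range m
  , window-disjoint m
  , a≢b
  , a∪b
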